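{- If $|A|=1$, then the inequational theory of $\mathrm{BCCS}(A)$ modulo the weak impossible futures preorder $\sqsubseteq_{\rm WIF}$ does not have a finite basis, i.e. there is no finite inequational axiomatization that is sound, ground-complete and $\omega$-complete for $\mathrm{BCCS}(A)$ modulo $\sqsubseteq_{\rm WIF}$.
   Context: $\mathrm{BCCS}(A)$: $A$ nonempty set of visible actions, $\tau\notin A$, countably infinite variable set $V$; terms $t::=\mathbf{0}\mid\alpha t\mid t+t\mid x$, $\alpha\in A\cup\{\tau\}$. Transitions: $\alpha t\xrightarrow{\alpha}t$; if $t\xrightarrow{\alpha}t'$ then $t+u\xrightarrow{\alpha}t'$, $u+t\xrightarrow{\alpha}t'$. $\Rightarrow$: zero or more $\tau$-steps. Traces $\mathcal{T}(p)$ of closed $p$: $a_1\cdots a_k\in A^*$ with $p\Rightarrow\xrightarrow{a_1}\Rightarrow\cdots\Rightarrow\xrightarrow{a_k}\Rightarrow p_k$. $(a_1\cdots a_k,B)$, $B\subseteq A^*$, is a weak impossible future of $p$ if such a path exists with $\mathcal{T}(p_k)\cap B=\emptyset$. $p\sqsubseteq_{\rm WIF}q$ iff (1) every weak impossible future of $p$ is one of $q$, (2) $\mathcal{T}(p)=\mathcal{T}(q)$, (3) $p\xrightarrow{\tau}$ implies $q\xrightarrow{\tau}$; for open terms via all closed substitutions. Inequational logic: reflexivity, transitivity, substitution, closure under BCCS operators. Sound: derivable $t\preccurlyeq u$ implies $t\sqsubseteq_{\rm WIF}u$; ground-complete: $p\sqsubseteq_{\rm WIF}q$ for closed $p,q$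 implies $p\preccurlyeq q$ derivable; $\omega$-complete: if $\sigma(t)\preccurlyeq\sigma(u)$ is derivable for all closed substitutions $\sigma$ then $t\preccurlyeq u$ is derivable. -}

module Defs where

open import Data.Nat using (ℕ)
open import Data.Empty using (⊥)
open import Data.List using (List; []; _∷_)
open import Data.List.Membership.Propositional using (_∈_)
open import Data.Product using (Σ; ∃; _×_; _,_)
open import Relation.Nullary using (¬_)
open import Level using (Level; 0ℓ) renaming (suc to lsuc)

-- BCCS(A): actions, terms over a variable type X (X = ℕ for open terms,
-- the countably infinite variable set V; X = ⊥ for closed terms)

data Act (A : Set) : Set where
  τ   : Act A
  vis : A → Act A

data Term (A : Set) (X : Set) : Set where
  𝟎   : Term A X
  _·_ : Act A → Term A X → Term A X
  _⊕_ : Term A X → Term A X → Term A X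
  var : X → Term A X

infixr 6 _·_
infixl 5 _⊕_

OTerm : Set → Set
OTerm A = Term A ℕ

CTerm : Set → Set
CTerm A = Term A ⊥

subst : ∀ {A X Y} → (X → Term A Y) → Term A X → Term A Y
subst σ 𝟎       = 𝟎
subst σ (α · t) = α · subst σ t
subst σ (t ⊕ u) = subst σ t ⊕ subst σ u
subst σ (var x) = σ x

embed : ∀ {A} → CTerm A → OTerm A
embed 𝟎       = 𝟎
embed (α · t) = α · embed t
embed (t ⊕ u) = embed t ⊕ embed u
embed (var ())

module Semantics {A : Set} where

  data _─[_]→_ : CTerm A → Act A → CTerm A → Set where
    pre  : ∀ {α t} → (α · t) ─[ α ]→ t
    sumˡ : ∀ {t u α t'} → t ─[ α ]→ t' → (t ⊕ u) ─[ α ]→ t'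
    sumʳ : ∀ {t u α t'} → t ─[ α ]→ t' → (u ⊕ t) ─[ α ]→ t'

  data _⇒_ : CTerm A → CTerm A → Set where
    ε   : ∀ {p} → p ⇒ p
    _◅_ : ∀ {p p' p''} → p ─[ τ ]→ p' → p' ⇒ p'' → p ⇒ p''

  data _=[_]⇒_ : CTerm A → List A → CTerm A → Set where
    done : ∀ {p p'} → p ⇒ p' → p =[ [] ]⇒ p'
    step : ∀ {p p₁ p₂ p' a w} → p ⇒ p₁ → p₁ ─[ vis a ]→ p₂ →
           p₂ =[ w ]⇒ p' → p =[ a ∷ w ]⇒ p'

  Trace : CTerm A → List A → Set
  Trace p w = ∃ λ p' → p =[ w ]⇒ p'

  WIF : CTerm A → List A → (List A → Set) → Set
  WIF p w B = ∃ λ p' → p =[ w ]⇒ p' × (∀ v → B v → ¬ Trace p' v)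

  HasTau : CTerm A → Set
  HasTau p = ∃ λ p' → p ─[ τ ]→ p'

  _⊑WIF_ : CTerm A → CTerm A → Set₁
  p ⊑WIF q = (∀ w B → WIF p w B → WIF q w B)
           × (∀ w → (Trace p w → Trace q w) × (Trace q w → Trace p w))
           × (HasTau p → HasTau q)

  _⊑WIFᵒ_ : OTerm A → OTerm A → Set₁
  t ⊑WIFᵒ u = ∀ (σ : ℕ → CTerm A) → subst σ t ⊑WIF subst σ u

module Logic {A : Set} where

  Axioms : Set
  Axioms = List (OTerm A × OTerm A)

  infix 4 _⊢_≼_
  data _⊢_≼_ (E : Axioms) : OTerm A → OTerm A → Set where
    ax    : ∀ {t u} → (t , u) ∈ E → E ⊢ t ≼ u
    refl  : ∀ {t} → E ⊢ t ≼ t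
    trans : ∀ {t u v} → E ⊢ t ≼ u → E ⊢ u ≼ v → E ⊢ t ≼ v
    sub   : ∀ {t u} (ρ : ℕ → OTerm A) → E ⊢ t ≼ u → E ⊢ subst ρ t ≼ subst ρ u
    pre   : ∀ {t u} (α : Act A) → E ⊢ t ≼ u → E ⊢ α · t ≼ α · u
    plus  : ∀ {t t' u u'} → E ⊢ t ≼ t' → E ⊢ u ≼ u' → E ⊢ t ⊕ u ≼ t' ⊕ u'

  open Semantics {A}

  Sound : Axioms → Set₁
  Sound E = ∀ t u → E ⊢ t ≼ u → t ⊑WIFᵒ u

  GroundComplete : Axioms → Set₁
  GroundComplete E = ∀ (p q : CTerm A) → p ⊑WIF q → E ⊢ embed p ≼ embed q

  OmegaComplete : Axioms → Set
  OmegaComplete E = ∀ t u →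
    (∀ (σ : ℕ → CTerm A) → E ⊢ embed (subst σ t) ≼ embed (subst σ u)) →
    E ⊢ t ≼ u

  FiniteBasis : Set₁
  FiniteBasis = Σ Axioms λ E → Sound E × GroundComplete E × OmegaComplete E

-- Write a for the unique action and let n bound the depth of the axioms of a sound
-- inequational theory E. For every closed p, a^(n+1) p ⊑WIF a^(n+1) p + p, so a
-- finite basis would derive a^(n+1) x ≼ a^(n+1) x + x. But derivations from E
-- cannot create the summand x: if x is a summand of the right-hand side and the
-- instance x ↦ a·0 of it is stable and no run of 2..n+1 actions gets stuck, then x
-- is a summand of the left-hand side as well. For an axiom l ≼ r this is seen by
-- substituting a^(n+1) 0 for the relevant summand y of r: the trace a^(n+1) of that
-- instance of r must then be matched by l, which is only possible if y is a summand
-- of l, since any occurrence of y deeper in r would produce an early deadlock.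
module Submission where

open import Defs
open import Data.Empty using (⊥-elim)
open import Data.List using (List; []; _∷_; [_]; length; replicate)
open import Data.List.Properties using (length-replicate)
open import Data.List.Membership.Propositional using (_∈_)
open import Data.List.Relation.Unary.Any using (here; there)
open import Data.Nat using (ℕ; zero; suc; _+_; _⊔_; _≤_; _<_; z≤n; s≤s)
open import Data.Nat.Properties
  using (≤-refl; ≤-trans; ≤-reflexive; n≤1+n; m≤m⊔n; m≤n⊔m; m≤n+m; <⇒≱;
         +-identityʳ; +-monoʳ-≤; +-cancelʳ-≤; _≟_)
open import Data.Product using (∃; ∃₂; _×_; _,_; proj₁; proj₂)
open import Data.Sum using (_⊎_; inj₁; inj₂)
open import Data.Unit using (⊤; tt)
open import Function using (_∘_)
open import Function.Bundles using (_↔_; Inverse)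
open import Relation.Nullary using (¬_; yes; no)
open import Relation.Binary.PropositionalEquality
  using (_≡_; refl; sym; cong; cong₂) renaming (subst to ≡-subst)

module _ {A : Set} where

  data Step {X : Set} : Term A X → Act A → Term A X → Set where
    pre  : ∀ {α t} → Step (α · t) α t
    sumˡ : ∀ {t u α t'} → Step t α t' → Step (t ⊕ u) α t'
    sumʳ : ∀ {t u α t'} → Step t α t' → Step (u ⊕ t) α t'

  infixr 5 _τ∷_ _v∷_
  data Run {X : Set} : Term A X → ℕ → Term A X → Set where
    stop  : ∀ {p} → Run p 0 p
    _τ∷_ : ∀ {p p' k q} → Step p τ p' → Run p' k q → Run p k q
    _v∷_ : ∀ {p p' k q b} → Step p (vis b) p' → Run p' k q → Run p (suc k) q

  infix 4 _∈top_
  data _∈top_ {X : Set} (z : X) : Term A X → Set where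
    here : z ∈top var z
    ⊕ˡ   : ∀ {t u} → z ∈top t → z ∈top t ⊕ u
    ⊕ʳ   : ∀ {t u} → z ∈top u → z ∈top t ⊕ u

  depth : ∀ {X} → Term A X → ℕ
  depth 𝟎       = 0
  depth (α · t) = suc (depth t)
  depth (t ⊕ u) = depth t ⊔ depth u
  depth (var _) = 0

  subst-∘ : ∀ {X Y Z} (σ : Y → Term A Z) (ρ : X → Term A Y) t →
            subst σ (subst ρ t) ≡ subst (subst σ ∘ ρ) t
  subst-∘ σ ρ 𝟎       = refl
  subst-∘ σ ρ (α · t) = cong (α ·_) (subst-∘ σ ρ t)
  subst-∘ σ ρ (t ⊕ u) = cong₂ _⊕_ (subst-∘ σ ρ t) (subst-∘ σ ρ u)
  subst-∘ σ ρ (var x) = refl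

  ∈top-subst : ∀ {X Y} (ρ : X → Term A Y) {t y z} → y ∈top t → z ∈top ρ y → z ∈top subst ρ t
  ∈top-subst ρ here     z∈ = z∈
  ∈top-subst ρ (⊕ˡ y∈t) z∈ = ⊕ˡ (∈top-subst ρ y∈t z∈)
  ∈top-subst ρ (⊕ʳ y∈t) z∈ = ⊕ʳ (∈top-subst ρ y∈t z∈)

  ∈top-subst⁻ : ∀ {X Y} (ρ : X → Term A Y) t {z} → z ∈top subst ρ t →
                ∃ λ y → y ∈top t × z ∈top ρ y
  ∈top-subst⁻ ρ (t ⊕ u) (⊕ˡ z∈) with ∈top-subst⁻ ρ t z∈
  ... | y , y∈t , z∈ρy = y , ⊕ˡ y∈t , z∈ρy
  ∈top-subst⁻ ρ (t ⊕ u) (⊕ʳ z∈) with ∈top-subst⁻ ρ u z∈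
  ... | y , y∈u , z∈ρy = y , ⊕ʳ y∈u , z∈ρy
  ∈top-subst⁻ ρ (var y) z∈ = y , here , z∈

  step-subst : ∀ {X Y} (σ : X → Term A Y) {t α t'} → Step t α t' → Step (subst σ t) α (subst σ t')
  step-subst σ pre       = pre
  step-subst σ (sumˡ st) = sumˡ (step-subst σ st)
  step-subst σ (sumʳ st) = sumʳ (step-subst σ st)

  step-summand : ∀ {X Y} (σ : X → Term A Y) {z t α p} →
                 z ∈top t → Step (σ z) α p → Step (subst σ t) α p
  step-summand σ here     st = st
  step-summand σ (⊕ˡ z∈t) st = sumˡ (step-summand σ z∈t st)
  step-summand σ (⊕ʳ z∈t) st = sumʳ (step-summand σ z∈t st)

  data SubstStep {X Y} (σ : X → Term A Y) (t : Term A X) (α : Act A) : Term A Y → Set where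
    inner   : ∀ {t'} → Step t α t' → SubstStep σ t α (subst σ t')
    through : ∀ {z p} → z ∈top t → Step (σ z) α p → SubstStep σ t α p

  step-subst⁻ : ∀ {X Y} (σ : X → Term A Y) t {α p} → Step (subst σ t) α p → SubstStep σ t α p
  step-subst⁻ σ (α · t) pre = inner pre
  step-subst⁻ σ (t ⊕ u) (sumˡ st) with step-subst⁻ σ t st
  ... | inner st'       = inner (sumˡ st')
  ... | through z∈t st' = through (⊕ˡ z∈t) st'
  step-subst⁻ σ (t ⊕ u) (sumʳ st) with step-subst⁻ σ u st
  ... | inner st'       = inner (sumʳ st')
  ... | through z∈u st' = through (⊕ʳ z∈u) st'
  step-subst⁻ σ (var z) st = through here st

  stable-subst : ∀ {X Y} (σ : X → Term A Y) {t} → (∀ {t'} → ¬ Step t τ t') →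
                 (∀ z {p} → ¬ Step (σ z) τ p) → ∀ {p} → ¬ Step (subst σ t) τ p
  stable-subst σ {t} t-stable σ-stable st with step-subst⁻ σ t st
  ... | inner st'         = t-stable st'
  ... | through {z} _ st' = σ-stable z st'

  run-subst : ∀ {X Y} (σ : X → Term A Y) {t k s} → Run t k s → Run (subst σ t) k (subst σ s)
  run-subst σ stop     = stop
  run-subst σ (st τ∷ R) = step-subst σ st τ∷ run-subst σ R
  run-subst σ (st v∷ R) = step-subst σ st v∷ run-subst σ R

  run-summand : ∀ {X Y} (σ : X → Term A Y) {z t k p} →
                z ∈top t → Run (σ z) (suc k) p → Run (subst σ t) (suc k) p
  run-summand σ z∈t (st τ∷ R) = step-summand σ z∈t st τ∷ R
  run-summand σ z∈t (st v∷ R) = step-summand σ z∈t st v∷ R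

  data SubstRun {X Y} (σ : X → Term A Y) (t : Term A X) : ℕ → Term A Y → Set where
    inner   : ∀ {k s} → Run t k s → SubstRun σ t k (subst σ s)
    through : ∀ {d k s z p} → Run t d s → z ∈top s → Run (σ z) k p → SubstRun σ t (d + k) p

  run-subst⁻ : ∀ {X Y} (σ : X → Term A Y) t {k p} → Run (subst σ t) k p → SubstRun σ t k p
  run-subst⁻ σ t stop = inner stop
  run-subst⁻ σ t (st τ∷ R) with step-subst⁻ σ t st
  ... | through z∈t st' = through stop z∈t (st' τ∷ R)
  ... | inner {t'} st' with run-subst⁻ σ t' R
  ...   | inner R'         = inner (st' τ∷ R')
  ...   | through R' z∈ Rz = through (st' τ∷ R') z∈ Rz
  run-subst⁻ σ t (st v∷ R) with step-subst⁻ σ t st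
  ... | through z∈t st' = through stop z∈t (st' v∷ R)
  ... | inner {t'} st' with run-subst⁻ σ t' R
  ...   | inner R'         = inner (st' v∷ R')
  ...   | through R' z∈ Rz = through (st' v∷ R') z∈ Rz

  run-++ : ∀ {X} {p q r : Term A X} {k k'} → Run p k q → Run q k' r → Run p (k + k') r
  run-++ stop      R' = R'
  run-++ (st τ∷ R) R' = st τ∷ run-++ R R'
  run-++ (st v∷ R) R' = st v∷ run-++ R R'

  run-∷ʳ : ∀ {X} {p q q' : Term A X} {k b} → Run p k q → Step q (vis b) q' → Run p (suc k) q'
  run-∷ʳ stop      st' = st' v∷ stop
  run-∷ʳ (st τ∷ R) st' = st τ∷ run-∷ʳ R st'
  run-∷ʳ (st v∷ R) st' = st v∷ run-∷ʳ R st'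

  run-prefix : ∀ {X} {p q : Term A X} {j k} → Run p k q → j ≤ k → ∃ (Run p j)
  run-prefix stop      z≤n      = _ , stop
  run-prefix (st τ∷ R) j≤k      = let q , R' = run-prefix R j≤k in q , st τ∷ R'
  run-prefix (st v∷ R) z≤n      = _ , stop
  run-prefix (st v∷ R) (s≤s j≤k) = let q , R' = run-prefix R j≤k in q , st v∷ R'

  run-stable : ∀ {X} {t s : Term A X} → (∀ {t'} → ¬ Step t τ t') → Run t 0 s → s ≡ t
  run-stable t-stable stop      = refl
  run-stable t-stable (st τ∷ _) = ⊥-elim (t-stable st)

  step-depth : ∀ {X} {t t' : Term A X} {α} → Step t α t' → depth t' < depth t
  step-depth pre = ≤-refl
  step-depth {t = t ⊕ u} (sumˡ st) = ≤-trans (step-depth st) (m≤m⊔n (depth t) (depth u))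
  step-depth {t = u ⊕ t} (sumʳ st) = ≤-trans (step-depth st) (m≤n⊔m (depth u) (depth t))

  run-depth : ∀ {X} {t s : Term A X} {k} → Run t k s → k ≤ depth t
  run-depth stop      = z≤n
  run-depth (st τ∷ R) = ≤-trans (run-depth R) (≤-trans (n≤1+n _) (step-depth st))
  run-depth (st v∷ R) = ≤-trans (s≤s (run-depth R)) (step-depth st)

  run-⊕ˡ : ∀ {X} {p q r : Term A X} {k} → Run p (suc k) q → Run (p ⊕ r) (suc k) q
  run-⊕ˡ (st τ∷ R) = sumˡ st τ∷ R
  run-⊕ˡ (st v∷ R) = sumˡ st v∷ R

  run-⊕ʳ : ∀ {X} {p q r : Term A X} {k} → Run q (suc k) r → Run (p ⊕ q) (suc k) r
  run-⊕ʳ (st τ∷ R) = sumʳ st τ∷ R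
  run-⊕ʳ (st v∷ R) = sumʳ st v∷ R

  run-⊕⁻ : ∀ {X} {p q r : Term A X} {k} → Run (p ⊕ q) (suc k) r → Run p (suc k) r ⊎ Run q (suc k) r
  run-⊕⁻ (sumˡ st τ∷ R) = inj₁ (st τ∷ R)
  run-⊕⁻ (sumʳ st τ∷ R) = inj₂ (st τ∷ R)
  run-⊕⁻ (sumˡ st v∷ R) = inj₁ (st v∷ R)
  run-⊕⁻ (sumʳ st v∷ R) = inj₂ (st v∷ R)

  runs-⊕ˡ : ∀ {X} {p q r : Term A X} {k} → Run p k q → ∃ (Run (p ⊕ r) k)
  runs-⊕ˡ {k = zero}  R = _ , stop
  runs-⊕ˡ {k = suc k} R = _ , run-⊕ˡ R

  open Semantics {A}

  step⇒─→ : ∀ {p α q} → Step p α q → p ─[ α ]→ q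
  step⇒─→ pre       = pre
  step⇒─→ (sumˡ st) = sumˡ (step⇒─→ st)
  step⇒─→ (sumʳ st) = sumʳ (step⇒─→ st)

  ─→⇒step : ∀ {p α q} → p ─[ α ]→ q → Step p α q
  ─→⇒step pre       = pre
  ─→⇒step (sumˡ st) = sumˡ (─→⇒step st)
  ─→⇒step (sumʳ st) = sumʳ (─→⇒step st)

  ⇒-run : ∀ {p q} → p ⇒ q → Run p 0 q
  ⇒-run ε        = stop
  ⇒-run (st ◅ h) = ─→⇒step st τ∷ ⇒-run h

  path⇒run : ∀ {p w q} → p =[ w ]⇒ q → Run p (length w) q
  path⇒run (done h)      = ⇒-run h
  path⇒run (step h st P) = run-++ (⇒-run h) (─→⇒step st v∷ path⇒run P)

  path-⊕ˡ : ∀ {p r w q} → p =[ w ]⇒ q → (w ≡ [] × q ≡ p) ⊎ ((p ⊕ r) =[ w ]⇒ q)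
  path-⊕ˡ (done ε)              = inj₁ (refl , refl)
  path-⊕ˡ (done (st ◅ h))       = inj₂ (done (sumˡ st ◅ h))
  path-⊕ˡ (step ε st P)         = inj₂ (step ε (sumˡ st) P)
  path-⊕ˡ (step (st ◅ h) st' P) = inj₂ (step (sumˡ st ◅ h) st' P)

  path-τ∷ : ∀ {p p' w q} → p ─[ τ ]→ p' → p' =[ w ]⇒ q → p =[ w ]⇒ q
  path-τ∷ st (done h)       = done (st ◅ h)
  path-τ∷ st (step h st' P) = step (st ◅ h) st' P

-- From here on A has a single action a, so a trace is determined by its length.
module SingleAction {A : Set} (a : A) (uniq : ∀ b → b ≡ a) where
  open Semantics {A}
  open Logic {A}

  pow : ∀ {X} → ℕ → Term A X → Term A X
  pow zero    s = s
  pow (suc k) s = vis a · pow k s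

  subst-pow : ∀ {X Y} (σ : X → Term A Y) k s → subst σ (pow k s) ≡ pow k (subst σ s)
  subst-pow σ zero    s = refl
  subst-pow σ (suc k) s = cong (vis a ·_) (subst-pow σ k s)

  depth-pow-𝟎 : ∀ {X} k → depth (pow {X} k 𝟎) ≡ k
  depth-pow-𝟎 zero    = refl
  depth-pow-𝟎 (suc k) = cong suc (depth-pow-𝟎 k)

  run-pow : ∀ {X} k (s : Term A X) → Run (pow k s) k s
  run-pow zero    s = stop
  run-pow (suc k) s = pre v∷ run-pow k s

  replicate-length : (w : List A) → w ≡ replicate (length w) a
  replicate-length []      = refl
  replicate-length (b ∷ w) = cong₂ _∷_ (uniq b) (replicate-length w)

  run⇒path : ∀ {p k q} → Run p k q → p =[ replicate k a ]⇒ q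
  run⇒path stop      = done ε
  run⇒path (st τ∷ R) = path-τ∷ (step⇒─→ st) (run⇒path R)
  run⇒path (_v∷_ {b = b} st R) with uniq b
  ... | refl = step ε (step⇒─→ st) (run⇒path R)

  path⇒run′ : ∀ {p k q} → p =[ replicate k a ]⇒ q → Run p k q
  path⇒run′ {p} {k} {q} P = ≡-subst (λ j → Run p j q) (length-replicate k) (path⇒run P)

  runs⇒traces : ∀ {p p'} → (∀ {k q} → Run p k q → ∃ (Run p' k)) → ∀ {w} → Trace p w → Trace p' w
  runs⇒traces {p' = p'} runs {w} (q , P) =
    let q' , R = runs (path⇒run P)
    in  q' , ≡-subst (λ v → p' =[ v ]⇒ q') (sym (replicate-length w)) (run⇒path R)

  traces⇒runs : ∀ {p p'} → (∀ w → Trace p w → Trace p' w) → ∀ {k q} → Run p k q → ∃ (Run p' k)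
  traces⇒runs traces R = let q' , P = traces _ (_ , run⇒path R) in q' , path⇒run′ P

  absorb : ∀ k (p : CTerm A) {m q} → Run (pow (suc k) p ⊕ p) m q → ∃ (Run (pow (suc k) p) m)
  absorb k p {zero}  R = _ , stop
  absorb k p {suc m} R with run-⊕⁻ R
  ... | inj₁ R' = _ , R'
  ... | inj₂ R' = run-prefix (run-++ (run-pow (suc k) p) R') (m≤n+m (suc m) (suc k))

  pow-⊑-pow-⊕ : ∀ k (p : CTerm A) → pow (suc k) p ⊑WIF (pow (suc k) p ⊕ p)
  pow-⊑-pow-⊕ k p = wif , (λ w → runs⇒traces runs-⊕ˡ , runs⇒traces (absorb k p)) , λ { (_ , ()) }
    where
      wif : ∀ w B → WIF (pow (suc k) p) w B → WIF (pow (suc k) p ⊕ p) w B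
      wif w B (q , P , none) with path-⊕ˡ P
      ... | inj₁ (refl , refl) = _ , done ε , λ v v∈B tr → none v v∈B (runs⇒traces (absorb k p) tr)
      ... | inj₂ P'            = q , P' , none

  Stuck : CTerm A → Set
  Stuck q = ∀ {q'} → ¬ Run q 1 q'

  -- Runs with a single action are exempt: the summand x of a^(k+1) x + x may deadlock after one.
  record Live (N : ℕ) (p : CTerm A) : Set where
    field
      stable : ∀ {p'} → ¬ Step p τ p'
      live   : ∀ {k q} → 2 + k ≤ N → Run p (2 + k) q → ¬ Stuck q
  open Live

  stuck⇒wif : ∀ {p k q} → Run p k q → Stuck q → WIF p (replicate k a) (_≡ [ a ])
  stuck⇒wif R stuck = _ , run⇒path R , λ { _ refl (_ , P) → stuck (path⇒run P) }

  wif⇒stuck : ∀ {p k} → WIF p (replicate k a) (_≡ [ a ]) → ∃ λ q → Run p k q × Stuck q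
  wif⇒stuck (q , P , none) = q , path⇒run′ P , λ R → none _ refl (_ , run⇒path R)

  Live-⊑ : ∀ {N p q} → p ⊑WIF q → Live N q → Live N p
  Live-⊑ (wif⊆ , _ , τ⊆) q-live = record
    { stable = λ st → stable q-live (─→⇒step (proj₂ (τ⊆ (_ , step⇒─→ st))))
    ; live   = λ bound R stuck →
        let _ , R' , stuck' = wif⇒stuck (wif⊆ _ _ (stuck⇒wif R stuck))
        in  live q-live bound R' stuck'
    }

  Live-⊕ˡ : ∀ {N p q} → Live N (p ⊕ q) → Live N p
  Live-⊕ˡ pq-live = record
    { stable = stable pq-live ∘ sumˡ
    ; live   = λ bound → live pq-live bound ∘ run-⊕ˡ
    }

  Live-⊕ʳ : ∀ {N p q} → Live N (p ⊕ q) → Live N q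
  Live-⊕ʳ pq-live = record
    { stable = stable pq-live ∘ sumʳ
    ; live   = λ bound → live pq-live bound ∘ run-⊕ʳ
    }

  pow-not-stuck : ∀ j {k q} → Run (pow j (vis a · 𝟎)) k q → k ≤ j → ¬ Stuck q
  pow-not-stuck zero    stop      z≤n       stuck = stuck (pre v∷ stop)
  pow-not-stuck (suc j) stop      _         stuck = stuck (pre v∷ stop)
  pow-not-stuck (suc j) (pre v∷ R) (s≤s k≤j) stuck = pow-not-stuck j R k≤j stuck

  Live-pow-⊕ : ∀ n → Live (suc n) (pow (suc n) (vis a · 𝟎) ⊕ vis a · 𝟎)
  Live-pow-⊕ n = record
    { stable = λ { (sumˡ ()) ; (sumʳ ()) }
    ; live   = λ bound R → no-early-deadlock R bound
    }
    where
      no-early-deadlock : ∀ {k q} → Run (pow (suc n) (vis a · 𝟎) ⊕ vis a · 𝟎) (2 + k) q →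
                          2 + k ≤ suc n → ¬ Stuck q
      no-early-deadlock R bound with run-⊕⁻ R
      ... | inj₁ R' = pow-not-stuck (suc n) R' bound
      ... | inj₂ R' with run-depth R'
      ...   | s≤s ()

  spike : ℕ → ℕ → ℕ → CTerm A
  spike n y z with z ≟ y
  ... | yes _ = pow (suc n) 𝟎
  ... | no _  = 𝟎

  module _ (n y : ℕ) where

    spike-y : spike n y y ≡ pow (suc n) 𝟎
    spike-y with y ≟ y
    ... | yes _  = refl
    ... | no y≢y = ⊥-elim (y≢y refl)

    spike-stable : ∀ z {p} → ¬ Step (spike n y z) τ p
    spike-stable z st with z ≟ y
    spike-stable z () | yes _
    spike-stable z () | no _

    spike-run : ∀ z {k p} → Run (spike n y z) (suc k) p → z ≡ y × suc k ≤ suc n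
    spike-run z {k} R with z ≟ y
    ... | yes z≡y = z≡y , ≡-subst (suc k ≤_) (depth-pow-𝟎 (suc n)) (run-depth R)
    ... | no _ with run-depth R
    ...   | ()

    run-spike-y : Run (spike n y y) (suc n) 𝟎
    run-spike-y = ≡-subst (λ s → Run s (suc n) 𝟎) (sym spike-y) (run-pow (suc n) 𝟎)

    -- Since t itself is too shallow, a run of length at least n+1 must enter a^(n+1) 0.
    spike-long-run : ∀ {t k p} → depth t ≤ n → suc n ≤ k → Run (subst (spike n y) t) k p →
                     ∃₂ λ d s → Run t d s × y ∈top s × k ≤ d + suc n
    spike-long-run {t} dt n<k R with run-subst⁻ (spike n y) t R
    ... | inner R' = ⊥-elim (<⇒≱ (s≤s dt) (≤-trans n<k (run-depth R')))
    ... | through {d} {zero} R' _ _ =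
      ⊥-elim (<⇒≱ (s≤s dt) (≤-trans (≤-trans n<k (≤-reflexive (+-identityʳ d))) (run-depth R')))
    ... | through {d} {suc k} {s} {z} R' z∈s Rz with spike-run z Rz
    ...   | refl , k≤n = d , s , R' , z∈s , +-monoʳ-≤ d k≤n

    module _ {l r : OTerm A} (l⊑r : l ⊑WIFᵒ r) where

      private
        instances = l⊑r (spike n y)

      spike-runs⇐ : ∀ {k q} → Run (subst (spike n y) r) k q → ∃ (Run (subst (spike n y) l) k)
      spike-runs⇐ = traces⇒runs (λ w → proj₂ (proj₁ (proj₂ instances) w))

      spike-runs⇒ : ∀ {k q} → Run (subst (spike n y) l) k q → ∃ (Run (subst (spike n y) r) k)
      spike-runs⇒ = traces⇒runs (λ w → proj₁ (proj₁ (proj₂ instances) w))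

      stable-reflected : (∀ {r'} → ¬ Step r τ r') → ∀ {l'} → ¬ Step l τ l'
      stable-reflected r-stable st =
        stable-subst (spike n y) r-stable spike-stable
          (─→⇒step (proj₂ (proj₂ (proj₂ instances) (_ , step⇒─→ (step-subst (spike n y) st)))))

      summand-reflected : depth l ≤ n → depth r ≤ n →
        (∀ {r'} → ¬ Step r τ r') → (∀ {d s} → 0 < d → Run r d s → ¬ y ∈top s) →
        y ∈top r → y ∈top l
      summand-reflected dl dr r-stable y-shallow y∈r
        with spike-long-run dl ≤-refl (proj₂ (spike-runs⇐ (run-summand (spike n y) y∈r run-spike-y)))
      ... | zero , s , R , y∈s , _ = ≡-subst (y ∈top_) (run-stable (stable-reflected r-stable) R) y∈s
      ... | suc d , s , R , y∈s , _
        with spike-long-run dr (m≤n+m (suc n) (suc d))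
               (proj₂ (spike-runs⇒ (run-++ (run-subst (spike n y) R)
                                           (run-summand (spike n y) y∈s run-spike-y))))
      ...   | d₂ , s₂ , R₂ , y∈s₂ , longer =
        ⊥-elim (y-shallow (≤-trans (s≤s z≤n) (+-cancelʳ-≤ (suc n) (suc d) d₂ longer)) R₂ y∈s₂)

  close : ℕ → CTerm A
  close zero    = vis a · 𝟎
  close (suc _) = 𝟎

  𝟎-stuck : Stuck 𝟎
  𝟎-stuck R with run-depth R
  ... | ()

  Live-close-pow-⊕ : ∀ n → Live (suc n) (subst close (subst var (pow (suc n) (var 0) ⊕ var 0)))
  Live-close-pow-⊕ n
    rewrite subst-pow var n (var {A} {ℕ} 0) | subst-pow close n (var {A} {ℕ} 0) = Live-pow-⊕ n

  module ShallowAxioms (E : Axioms) (sound : Sound E) (n : ℕ)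
                       (shallow : ∀ {l r} → (l , r) ∈ E → depth l ≤ n × depth r ≤ n) where

    sound-closed : ∀ {t u} → E ⊢ t ≼ u → ∀ ρ → subst close (subst ρ t) ⊑WIF subst close (subst ρ u)
    sound-closed {t} {u} D ρ
      rewrite subst-∘ close ρ t | subst-∘ close ρ u = sound t u D (subst close ∘ ρ)

    -- Reaching y after d > 0 actions, x₀ ∈top ρ y lets the closed instance stop after d + 1 ≤ n + 1.
    Live-summand-shallow : ∀ {ρ : ℕ → OTerm A} {r y} → Live (suc n) (subst close (subst ρ r)) →
                           depth r ≤ n → 0 ∈top ρ y → ∀ {d s} → 0 < d → Run r d s → ¬ y ∈top s
    Live-summand-shallow {ρ} r-live dr 0∈ρy {suc d} _ R y∈s =
      live r-live (s≤s (≤-trans (run-depth R) dr))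
        (run-∷ʳ (run-subst close (run-subst ρ R)) (step-summand close (∈top-subst ρ y∈s 0∈ρy) pre))
        𝟎-stuck

    summand-preserved : ∀ {t u} → E ⊢ t ≼ u → ∀ ρ → Live (suc n) (subst close (subst ρ u)) →
                        0 ∈top subst ρ u → 0 ∈top subst ρ t
    summand-preserved (ax {l} {r} l≼r∈E) ρ r-live 0∈r with ∈top-subst⁻ ρ r 0∈r
    ... | y , y∈r , 0∈ρy =
      let dl , dr = shallow l≼r∈E
      in  ∈top-subst ρ
            (summand-reflected n y {l} {r} (sound l r (ax l≼r∈E)) dl dr
              (λ st → stable r-live (step-subst close (step-subst ρ st)))
              (Live-summand-shallow r-live dr 0∈ρy) y∈r)
            0∈ρy
    summand-preserved refl ρ _ 0∈u = 0∈u
    summand-preserved (trans D₁ D₂) ρ u-live 0∈u =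
      summand-preserved D₁ ρ (Live-⊑ (sound-closed D₂ ρ) u-live) (summand-preserved D₂ ρ u-live 0∈u)
    summand-preserved (sub {t} {u} ρ' D) ρ u-live 0∈u
      rewrite subst-∘ ρ ρ' t | subst-∘ ρ ρ' u = summand-preserved D (subst ρ ∘ ρ') u-live 0∈u
    summand-preserved (pre α D) ρ _ ()
    summand-preserved (plus D₁ D₂) ρ u-live (⊕ˡ 0∈u) =
      ⊕ˡ (summand-preserved D₁ ρ (Live-⊕ˡ u-live) 0∈u)
    summand-preserved (plus D₁ D₂) ρ u-live (⊕ʳ 0∈u) =
      ⊕ʳ (summand-preserved D₂ ρ (Live-⊕ʳ u-live) 0∈u)

    pow-⊕-underivable : ¬ E ⊢ pow (suc n) (var 0) ≼ pow (suc n) (var 0) ⊕ var 0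
    pow-⊕-underivable D with summand-preserved D var (Live-close-pow-⊕ n) (⊕ʳ here)
    ... | ()

  maxDepth : Axioms → ℕ
  maxDepth []            = 0
  maxDepth ((l , r) ∷ E) = depth l ⊔ depth r ⊔ maxDepth E

  ∈-maxDepth : ∀ {l r} E → (l , r) ∈ E → depth l ≤ maxDepth E × depth r ≤ maxDepth E
  ∈-maxDepth ((l , r) ∷ E) (here refl) =
    ≤-trans (m≤m⊔n (depth l) (depth r)) (m≤m⊔n _ (maxDepth E)) ,
    ≤-trans (m≤n⊔m (depth l) (depth r)) (m≤m⊔n _ (maxDepth E))
  ∈-maxDepth ((l' , r') ∷ E) (there lr∈E) =
    let dl , dr = ∈-maxDepth E lr∈E
    in  ≤-trans dl (m≤n⊔m (depth l' ⊔ depth r') _) , ≤-trans dr (m≤n⊔m (depth l' ⊔ depth r') _)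

  no-finite-basis : ¬ FiniteBasis
  no-finite-basis (E , sound , ground , ω) =
    ShallowAxioms.pow-⊕-underivable E sound n (∈-maxDepth E) (ω _ _ closed-instances)
    where
      n = maxDepth E
      closed-instances : ∀ σ → E ⊢ embed (subst σ (pow (suc n) (var 0)))
                                 ≼ embed (subst σ (pow (suc n) (var 0) ⊕ var 0))
      closed-instances σ rewrite subst-pow σ n (var 0) = ground _ _ (pow-⊑-pow-⊕ n (σ 0))

theorem8 : (A : Set) → A ↔ ⊤ → ¬ Logic.FiniteBasis {A}
theorem8 A A↔⊤ =
  SingleAction.no-finite-basis (Inverse.from A↔⊤ tt) (λ b → sym (Inverse.strictlyInverseʳ A↔⊤ b))
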